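{- Let $G$ be a connected graph with $n$ vertices and chromatic number $k$, where $2\le k\le n-1$. Then $\sigma_0(G)\ge 2-\frac{k-1}{n}$ and $\sigma_1(G)\ge 4n-3k+3$, and in each bound equality holds if and only if $G=K_{k-1}\vee\overline{K}_{n+1-k}$. If instead $G$ is a connected graph with $n$ vertices and clique number $k$, where $2\le k\le n-1$, then the same two bounds hold, and in each equality holds if and only if $G$ has exactly $k-1$ dominating vertices.
   Context: Graphs are finite, simple and undirected. For a connected graph $G$ and vertex $u$, $\varepsilon_G(u)=\max_{v\in V(G)}d_G(u,v)$; $\sigma_0(G)=\frac1{|V(G)|}\sum_u\varepsilon_G(u)$ and $\sigma_1(G)=\sum_u\varepsilon_G(u)^2$. A dominating vertex in an $n$-vertex graph is a vertex of degree $n-1$. $K_m$ is the complete graph and $\overline{K}_m$ the edgeless graph on $m$ vertices; $G\vee H$ (join) is the disjoint union of $G$ and $H$ together with all edges between $V(G)$ and $V(H)$. -}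

module Defs where

open import Data.Bool using (Bool; true; false; if_then_else_)
open import Data.Nat using (ℕ; zero; suc; _+_; _*_; _∸_; _^_; _≤_; _<_; _≡ᵇ_)
open import Data.Fin using (Fin; splitAt; _≟_)
open import Relation.Nullary.Decidable using (does)
open import Data.List using (List; map; allFin)
open import Data.Nat.ListAction using (sum)
open import Data.Sum using (_⊎_; inj₁; inj₂)
open import Data.Product using (Σ; ∃; _×_; _,_)
open import Data.Integer using (ℤ; +_)
open import Data.Rational using (ℚ; 0ℚ; _/_)
open import Function.Definitions using (Injective)
open import Relation.Nullary using (¬_)
open import Relation.Binary.PropositionalEquality using (_≡_; _≢_; refl)

record Graph (n : ℕ) : Set where
  field
    adj   : Fin n → Fin n → Bool
    sym   : ∀ u v → adj u v ≡ adj v u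
    irrefl : ∀ u → adj u u ≡ false
open Graph public

Edge : ∀ {n} → Graph n → Fin n → Fin n → Set
Edge G u v = adj G u v ≡ true

data Walk {n} (G : Graph n) : Fin n → Fin n → ℕ → Set where
  here : ∀ {u} → Walk G u u zero
  step : ∀ {u w v ℓ} → Edge G u w → Walk G w v ℓ → Walk G u v (suc ℓ)

Connected : ∀ {n} → Graph n → Set
Connected G = ∀ u v → ∃ λ ℓ → Walk G u v ℓ

IsDist : ∀ {n} → Graph n → Fin n → Fin n → ℕ → Set
IsDist G u v d = Walk G u v d × (∀ ℓ → Walk G u v ℓ → d ≤ ℓ)

IsEcc : ∀ {n} → Graph n → Fin n → ℕ → Set
IsEcc {n} G u e = (∀ v d → IsDist G u v d → d ≤ e) × (∃ λ v → IsDist G u v e)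

Σᵥ : ∀ n → (Fin n → ℕ) → ℕ
Σᵥ n f = sum (map f (allFin n))

σ₁ : ∀ n → (Fin n → ℕ) → ℕ
σ₁ n ecc = Σᵥ n (λ u → ecc u ^ 2)

-- a / n as a rational, with the (irrelevant) convention a / 0 = 0
_//_ : ℤ → ℕ → ℚ
a // zero = 0ℚ
a // suc m = a / suc m

σ₀ : ∀ n → (Fin n → ℕ) → ℚ
σ₀ n ecc = (+ Σᵥ n ecc) // n

degree : ∀ {n} → Graph n → Fin n → ℕ
degree {n} G u = Σᵥ n (λ v → if adj G u v then 1 else 0)

numDominating : ∀ {n} → Graph n → ℕ
numDominating {n} G = Σᵥ n (λ u → if degree G u ≡ᵇ (n ∸ 1) then 1 else 0)

ProperColouring : ∀ {n} → Graph n → (j : ℕ) → (Fin n → Fin j) → Set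
ProperColouring G j c = ∀ u v → Edge G u v → c u ≢ c v

ChromaticNumber : ∀ {n} → Graph n → ℕ → Set
ChromaticNumber {n} G k =
  (Σ (Fin n → Fin k) (ProperColouring G k)) ×
  (∀ j → j < k → ¬ Σ (Fin n → Fin j) (ProperColouring G j))

IsClique : ∀ {n} → Graph n → (j : ℕ) → (Fin j → Fin n) → Set
IsClique G j f = Injective _≡_ _≡_ f × (∀ a b → a ≢ b → Edge G (f a) (f b))

CliqueNumber : ∀ {n} → Graph n → ℕ → Set
CliqueNumber {n} G k =
  (Σ (Fin k → Fin n) (IsClique G k)) ×
  (∀ j → k < j → ¬ Σ (Fin j → Fin n) (IsClique G j))

-- K_a ∨ \bar K_b on vertex set Fin (a + b): first a vertices form a clique,
-- last b vertices are independent, all edges between the two parts.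

joinAdj : (a b : ℕ) → Fin (a + b) → Fin (a + b) → Bool
joinAdj a b u v with splitAt a u | splitAt a v
... | inj₁ x | inj₁ y = if does (x ≟ y) then false else true
... | inj₁ _ | inj₂ _ = true
... | inj₂ _ | inj₁ _ = true
... | inj₂ _ | inj₂ _ = false

private
  dsym : ∀ {m} (x y : Fin m) → does (x ≟ y) ≡ does (y ≟ x)
  dsym x y with x ≟ y | y ≟ x
  ... | Relation.Nullary.yes _ | Relation.Nullary.yes _ = refl
  ... | Relation.Nullary.no _ | Relation.Nullary.no _ = refl
  ... | Relation.Nullary.yes refl | Relation.Nullary.no q = Data.Empty.⊥-elim (q refl)
    where import Data.Empty
  ... | Relation.Nullary.no p | Relation.Nullary.yes refl = Data.Empty.⊥-elim (p refl)
    where import Data.Empty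

  joinSym : ∀ a b u v → joinAdj a b u v ≡ joinAdj a b v u
  joinSym a b u v with splitAt a u | splitAt a v
  ... | inj₁ x | inj₁ y rewrite dsym x y = refl
  ... | inj₁ _ | inj₂ _ = refl
  ... | inj₂ _ | inj₁ _ = refl
  ... | inj₂ _ | inj₂ _ = refl

  joinIrr : ∀ a b u → joinAdj a b u u ≡ false
  joinIrr a b u with splitAt a u
  ... | inj₁ x with x ≟ x
  ...   | Relation.Nullary.yes _ = refl
  ...   | Relation.Nullary.no p = Data.Empty.⊥-elim (p refl)
    where import Data.Empty
  joinIrr a b u | inj₂ _ = refl

KjoinE : (a b : ℕ) → Graph (a + b)
KjoinE a b = record { adj = joinAdj a b ; sym = joinSym a b ; irrefl = joinIrr a b }

record _≅_ {n m : ℕ} (G : Graph n) (H : Graph m) : Set where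
  field
    to      : Fin n → Fin m
    from    : Fin m → Fin n
    from∘to : ∀ u → from (to u) ≡ u
    to∘from : ∀ v → to (from v) ≡ v
    pres    : ∀ u v → adj H (to u) (to v) ≡ adj G u v

module Submission where

-- In a connected graph on n ≥ 2 vertices a dominating vertex has eccentricity 1 and every other
-- vertex has eccentricity at least 2; if some vertex is dominating, all eccentricities are at most 2.
-- Hence, with D dominating vertices, Σ ε ≥ 2n − D and Σ ε² ≥ 4n − 3D, with equality once D ≥ 1.
-- The dominating vertices together with any further clique of non-dominating vertices form a clique.
-- So if no clique has more than k vertices (which holds for clique number k and for chromatic
-- number k) and G is not complete, then D ≤ k − 1; this gives both bounds, with equality exactly
-- when D = k − 1. For chromatic number k, D = k − 1 also makes the non-dominating vertices
-- independent (an edge between two of them would complete a clique on k + 1 vertices), which says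
-- precisely that G ≅ K_{k−1} ∨ K̄_{n+1−k}.

open import Defs hiding (sym)

open import Data.Bool using (Bool; true; false; not; if_then_else_)
import Data.Bool.Properties as BoolP
open import Data.Fin using (Fin; zero; suc; punchIn; punchOut; fromℕ<; splitAt; join; _↑ˡ_; _≟_)
import Data.Fin.Properties as FinP
open import Data.Integer as ℤ using (ℤ; +_)
import Data.Integer.Properties as ℤP
import Data.Integer.Tactic.RingSolver as ℤSolver
open import Data.List using (tabulate)
import Data.List.Properties as ListP
open import Data.Nat using (ℕ; zero; suc; _+_; _*_; _∸_; _^_; _≤_; _≰_; _<_; _≡ᵇ_; z≤n; s≤s; s≤s⁻¹)
open import Data.Nat.Induction using (<-rec)
open import Data.Nat.ListAction using (sum)
open import Data.Nat.Properties hiding (_≟_)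
open import Data.Nat.Tactic.RingSolver using (solve-∀)
open import Algebra.Properties.CommutativeMonoid.Sum +-0-commutativeMonoid
  using (sum-cong-≗; sum-remove) renaming (sum to ∑)
open import Data.Product using (∃; _×_; _,_; proj₁; proj₂)
open import Data.Rational as ℚ using (_-_; toℚᵘ) renaming (_≤_ to _≤ℚ_)
import Data.Rational.Properties as ℚP
open import Data.Rational.Unnormalised as ℚᵘ using (mkℚᵘ; *≡*; *≤*)
import Data.Rational.Unnormalised.Properties as ℚᵘP
open import Data.Sum using (_⊎_; inj₁; inj₂; [_,_]′)
import Data.Sum as Sum
import Data.Sum.Properties as SumP
open import Function using (_∘_; id)
open import Function.Bundles using (_⇔_; mk⇔; Equivalence)
open import Function.Definitions using (Injective)
open import Function.Properties.Equivalence using () renaming (trans to ⇔-trans)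
open import Relation.Nullary using (¬?; yes; no; Dec; contradiction)
import Relation.Nullary.Decidable as Dec
open import Relation.Nullary.Decidable using (_×-dec_)
open import Relation.Binary.PropositionalEquality

∸-≡⇔+ : ∀ {a b x} → b ≤ a → (x ≡ a ∸ b) ⇔ (b + x ≡ a)
∸-≡⇔+ {a} {b} {x} b≤a = mk⇔
  (λ x≡a∸b → trans (cong (_+_ b) x≡a∸b) (m+[n∸m]≡n b≤a))
  (λ b+x≡a → trans (sym (m+n∸m≡n b x)) (cong (_∸ b) b+x≡a))

+3∸3*suc : ∀ N K → N + 3 ∸ 3 * suc K ≡ N ∸ 3 * K
+3∸3*suc N K = trans (cong₂ _∸_ (+-comm N 3) (*-suc 3 K)) ([m+n]∸[m+o]≡n∸o 3 N (3 * K))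

squeeze : ∀ {x y s N} → x ≤ y → N ≤ x + s → y + s ≡ N → x ≡ y
squeeze {x} {y} {s} x≤y N≤x+s y+s≡N =
  ≤-antisym x≤y (+-cancelʳ-≤ s y x (subst (_≤ x + s) (sym y+s≡N) N≤x+s))

least : ∀ {P : ℕ → Set} → (∀ n → Dec (P n)) → ∀ {n} → P n → ∃ λ m → P m × (∀ k → P k → m ≤ k)
least {P} P? {n} = <-rec (λ n → P n → Least) search n
  where
  Least : Set
  Least = ∃ λ m → P m × (∀ k → P k → m ≤ k)
  search : ∀ n → (∀ {k} → k < n → P k → Least) → P n → Least
  search n below Pn with anyUpTo? P? n
  ... | yes (k , k<n , Pk) = below k<n Pk
  ... | no none            = n , Pn , λ k Pk → ≮⇒≥ (λ k<n → none (k , k<n , Pk))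

∑-mono-≤ : ∀ {n} {f g : Fin n → ℕ} → (∀ i → f i ≤ g i) → ∑ f ≤ ∑ g
∑-mono-≤ {zero}  _   = z≤n
∑-mono-≤ {suc n} f≤g = +-mono-≤ (f≤g zero) (∑-mono-≤ (f≤g ∘ suc))

sum-tabulate : ∀ {n} (f : Fin n → ℕ) → sum (tabulate f) ≡ ∑ f
sum-tabulate {zero}  f = refl
sum-tabulate {suc n} f = cong (_+_ (f zero)) (sum-tabulate (f ∘ suc))

Σᵥ≡∑ : ∀ n (f : Fin n → ℕ) → Σᵥ n f ≡ ∑ f
Σᵥ≡∑ n f = trans (cong sum (ListP.map-tabulate id f)) (sum-tabulate f)

count : ∀ {n} → (Fin n → Bool) → ℕ
count P = ∑ (λ i → if P i then 1 else 0)

count-complement : ∀ {n} (P : Fin n → Bool) → count P + count (not ∘ P) ≡ n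
count-complement {zero}  P = refl
count-complement {suc n} P with P zero
... | true  = cong suc (count-complement (P ∘ suc))
... | false = trans (+-suc _ _) (cong suc (count-complement (P ∘ suc)))

count≤n : ∀ {n} (P : Fin n → Bool) → count P ≤ n
count≤n {zero}  P = z≤n
count≤n {suc n} P with P zero
... | true  = s≤s (count≤n (P ∘ suc))
... | false = m≤n⇒m≤1+n (count≤n (P ∘ suc))

count≡n⇔all : ∀ {n} (P : Fin n → Bool) → count P ≡ n ⇔ (∀ i → P i ≡ true)
count≡n⇔all P = mk⇔ (to P) (from P)
  where
  to : ∀ {n} (P : Fin n → Bool) → count P ≡ n → ∀ i → P i ≡ true
  to {suc n} P eq i with P zero in P₀
  to {suc n} P eq zero    | true  = P₀
  to {suc n} P eq (suc i) | true  = to (P ∘ suc) (suc-injective eq) i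
  to {suc n} P eq i       | false = contradiction (subst (_≤ n) eq (count≤n (P ∘ suc))) (<⇒≱ ≤-refl)
  from : ∀ {n} (P : Fin n → Bool) → (∀ i → P i ≡ true) → count P ≡ n
  from {zero}  P _   = refl
  from {suc n} P all rewrite all zero = cong suc (from (P ∘ suc) (all ∘ suc))

private
  peel-true : ∀ c d s → c * (1 + d) + (1 + s) ≡ 1 + c + (c * d + s)
  peel-true = solve-∀

  peel-false : ∀ c d s → c * d + (1 + c + s) ≡ 1 + c + (c * d + s)
  peel-false = solve-∀

  peel : ∀ b c d s → c * ((if b then 1 else 0) + d) + ((if b then 1 else suc c) + s) ≡ suc c + (c * d + s)
  peel true  = peel-true
  peel false = peel-false

weightedCount : ∀ {n} c (P : Fin n → Bool) →
                c * count P + ∑ (λ i → if P i then 1 else suc c) ≡ suc c * n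
weightedCount {zero}  c P = +-identityʳ (c * 0)
weightedCount {suc n} c P = begin
  c * count P + ∑ (λ i → if P i then 1 else suc c)
    ≡⟨ peel (P zero) c (count (P ∘ suc)) _ ⟩
  suc c + (c * count (P ∘ suc) + ∑ (λ i → if P (suc i) then 1 else suc c))
    ≡⟨ cong (_+_ (suc c)) (weightedCount c (P ∘ suc)) ⟩
  suc c + suc c * n
    ≡⟨ *-suc (suc c) n ⟨
  suc c * suc n ∎
  where
  open ≡-Reasoning

weightedCount-≤ : ∀ {n} c (P : Fin n → Bool) (f : Fin n → ℕ) →
                  (∀ i → (if P i then 1 else suc c) ≤ f i) → suc c * n ≤ c * count P + ∑ f
weightedCount-≤ c P f le = begin
  suc c * _                                           ≡⟨ weightedCount c P ⟨
  c * count P + ∑ (λ i → if P i then 1 else suc c)   ≤⟨ +-monoʳ-≤ (c * count P) (∑-mono-≤ le) ⟩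
  c * count P + ∑ f                                   ∎
  where open ≤-Reasoning

weightedCount-≡ : ∀ {n} c (P : Fin n → Bool) (f : Fin n → ℕ) →
                  (∀ i → f i ≡ (if P i then 1 else suc c)) → c * count P + ∑ f ≡ suc c * n
weightedCount-≡ c P f eq = trans (cong (_+_ (c * count P)) (sum-cong-≗ eq)) (weightedCount c P)

-- Splitting Fin n along a predicate

Parts : ∀ {n} → (Fin n → Bool) → Set
Parts P = Fin (count P) ⊎ Fin (count (not ∘ P))

-- One recursion step: the new element zero goes to the side selected by b = P zero.
private
  Parts⁺ : Bool → ℕ → ℕ → Set
  Parts⁺ b a c = Fin ((if b then 1 else 0) + a) ⊎ Fin ((if not b then 1 else 0) + c)

  split⁺ : ∀ {n a c} b → (Fin n → Fin a ⊎ Fin c) → Fin (suc n) → Parts⁺ b a c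
  split⁺ true  s zero    = inj₁ zero
  split⁺ false s zero    = inj₂ zero
  split⁺ true  s (suc i) = Sum.map₁ suc (s i)
  split⁺ false s (suc i) = Sum.map₂ suc (s i)

  merge⁺ : ∀ {n a c} b → (Fin a ⊎ Fin c → Fin n) → Parts⁺ b a c → Fin (suc n)
  merge⁺ true  m (inj₁ zero)    = zero
  merge⁺ true  m (inj₁ (suc x)) = suc (m (inj₁ x))
  merge⁺ true  m (inj₂ y)       = suc (m (inj₂ y))
  merge⁺ false m (inj₁ x)       = suc (m (inj₁ x))
  merge⁺ false m (inj₂ zero)    = zero
  merge⁺ false m (inj₂ (suc y)) = suc (m (inj₂ y))

split : ∀ {n} (P : Fin n → Bool) → Fin n → Parts P
split {suc n} P = split⁺ (P zero) (split (P ∘ suc))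

merge : ∀ {n} (P : Fin n → Bool) → Parts P → Fin n
merge {zero}  P (inj₁ ())
merge {zero}  P (inj₂ ())
merge {suc n} P = merge⁺ (P zero) (merge (P ∘ suc))

isLeft : ∀ {A B : Set} → A ⊎ B → Bool
isLeft = [ (λ _ → true) , (λ _ → false) ]′

private
  merge⁺-split⁺ : ∀ {n a c} b (s : Fin n → Fin a ⊎ Fin c) m → (∀ i → m (s i) ≡ i) →
                  ∀ i → merge⁺ b m (split⁺ b s i) ≡ i
  merge⁺-split⁺ true  s m inv zero = refl
  merge⁺-split⁺ false s m inv zero = refl
  merge⁺-split⁺ true  s m inv (suc i) with s i | inv i
  ... | inj₁ x | eq = cong suc eq
  ... | inj₂ y | eq = cong suc eq
  merge⁺-split⁺ false s m inv (suc i) with s i | inv i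
  ... | inj₁ x | eq = cong suc eq
  ... | inj₂ y | eq = cong suc eq

  split⁺-merge⁺ : ∀ {n a c} b (s : Fin n → Fin a ⊎ Fin c) m → (∀ t → s (m t) ≡ t) →
                  ∀ t → split⁺ b s (merge⁺ b m t) ≡ t
  split⁺-merge⁺ true  s m inv (inj₁ zero)    = refl
  split⁺-merge⁺ true  s m inv (inj₁ (suc x)) = cong (Sum.map₁ suc) (inv (inj₁ x))
  split⁺-merge⁺ true  s m inv (inj₂ y)       = cong (Sum.map₁ suc) (inv (inj₂ y))
  split⁺-merge⁺ false s m inv (inj₁ x)       = cong (Sum.map₂ suc) (inv (inj₁ x))
  split⁺-merge⁺ false s m inv (inj₂ zero)    = refl
  split⁺-merge⁺ false s m inv (inj₂ (suc y)) = cong (Sum.map₂ suc) (inv (inj₂ y))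

  isLeft-split⁺-zero : ∀ {n a c} b (s : Fin n → Fin a ⊎ Fin c) → isLeft (split⁺ b s zero) ≡ b
  isLeft-split⁺-zero true  s = refl
  isLeft-split⁺-zero false s = refl

  isLeft-split⁺-suc : ∀ {n a c} b (s : Fin n → Fin a ⊎ Fin c) i →
                      isLeft (split⁺ b s (suc i)) ≡ isLeft (s i)
  isLeft-split⁺-suc true  s i with s i
  ... | inj₁ _ = refl
  ... | inj₂ _ = refl
  isLeft-split⁺-suc false s i with s i
  ... | inj₁ _ = refl
  ... | inj₂ _ = refl

merge-split : ∀ {n} (P : Fin n → Bool) i → merge P (split P i) ≡ i
merge-split {suc n} P = merge⁺-split⁺ (P zero) (split (P ∘ suc)) (merge (P ∘ suc)) (merge-split (P ∘ suc))

split-merge : ∀ {n} (P : Fin n → Bool) t → split P (merge P t) ≡ t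
split-merge {zero}  P (inj₁ ())
split-merge {zero}  P (inj₂ ())
split-merge {suc n} P = split⁺-merge⁺ (P zero) (split (P ∘ suc)) (merge (P ∘ suc)) (split-merge (P ∘ suc))

isLeft-split : ∀ {n} (P : Fin n → Bool) i → isLeft (split P i) ≡ P i
isLeft-split {suc n} P zero    = isLeft-split⁺-zero (P zero) (split (P ∘ suc))
isLeft-split {suc n} P (suc i) =
  trans (isLeft-split⁺-suc (P zero) (split (P ∘ suc)) i) (isLeft-split (P ∘ suc) i)

merge-injective : ∀ {n} (P : Fin n → Bool) {s t} → merge P s ≡ merge P t → s ≡ t
merge-injective P {s} {t} eq = trans (sym (split-merge P s)) (trans (cong (split P) eq) (split-merge P t))

P-merge : ∀ {n} (P : Fin n → Bool) t → P (merge P t) ≡ isLeft t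
P-merge P t = trans (sym (isLeft-split P (merge P t))) (cong isLeft (split-merge P t))

fromLeft : ∀ {A B : Set} (t : A ⊎ B) → isLeft t ≡ true → A
fromLeft (inj₁ x) _ = x

inj₁-fromLeft : ∀ {A B : Set} (t : A ⊎ B) (p : isLeft t ≡ true) → inj₁ (fromLeft t p) ≡ t
inj₁-fromLeft (inj₁ x) _ = refl

index : ∀ {n} (P : Fin n → Bool) u → P u ≡ true → Fin (count P)
index P u Pu = fromLeft (split P u) (trans (isLeft-split P u) Pu)

merge-index : ∀ {n} (P : Fin n → Bool) u (Pu : P u ≡ true) → merge P (inj₁ (index P u Pu)) ≡ u
merge-index P u Pu = trans (cong (merge P) (inj₁-fromLeft (split P u) _)) (merge-split P u)

count-≥ : ∀ {m n} (P : Fin n → Bool) (f : Fin m → Fin n) → Injective _≡_ _≡_ f →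
          (∀ i → P (f i) ≡ true) → m ≤ count P
count-≥ P f f-inj Pf = FinP.injective⇒≤ index∘f-injective
  where
  index∘f-injective : Injective _≡_ _≡_ (λ i → index P (f i) (Pf i))
  index∘f-injective {i} {j} eq = f-inj (begin
    f i                                ≡⟨ merge-index P (f i) (Pf i) ⟨
    merge P (inj₁ (index P (f i) _))   ≡⟨ cong (merge P ∘ inj₁) eq ⟩
    merge P (inj₁ (index P (f j) _))   ≡⟨ merge-index P (f j) (Pf j) ⟩
    f j                                ∎)
    where open ≡-Reasoning

//-mono-≤ : ∀ m {x y} → x ≤ y → (+ x) // suc m ≤ℚ (+ y) // suc m
//-mono-≤ m {x} {y} x≤y = ℚP.toℚᵘ-cancel-≤
  (ℚᵘP.≤-respˡ-≃ (ℚᵘP.≃-sym (ℚP.toℚᵘ-fromℚᵘ (mkℚᵘ (+ x) m)))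
  (ℚᵘP.≤-respʳ-≃ (ℚᵘP.≃-sym (ℚP.toℚᵘ-fromℚᵘ (mkℚᵘ (+ y) m)))
  (*≤* (subst₂ ℤ._≤_ (ℤP.pos-* x (suc m)) (ℤP.pos-* y (suc m)) (ℤ.+≤+ (*-monoˡ-≤ (suc m) x≤y))))))

//-injective : ∀ m {x y} → (+ x) // suc m ≡ (+ y) // suc m → x ≡ y
//-injective m {x} {y} eq with ℚP.fromℚᵘ-injective {mkℚᵘ (+ x) m} {mkℚᵘ (+ y) m} eq
... | *≡* x*n≡y*n = ℤP.+-injective (ℤP.*-cancelʳ-≡ (+ x) (+ y) (+ suc m) x*n≡y*n)

two-minus-// : ∀ m {a} → a ≤ 2 * suc m → (+ 2) // 1 - (+ a) // suc m ≡ (+ (2 * suc m ∸ a)) // suc m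
two-minus-// m {a} a≤2n = ℚP.toℚᵘ-injective (begin
  toℚᵘ ((+ 2) // 1 - (+ a) // suc m)
    ≈⟨ ℚP.toℚᵘ-homo-+ ((+ 2) // 1) (ℚ.- ((+ a) // suc m)) ⟩
  mkℚᵘ (+ 2) 0 ℚᵘ.+ toℚᵘ (ℚ.- ((+ a) // suc m))
    ≈⟨ ℚᵘP.+-congʳ (mkℚᵘ (+ 2) 0) (ℚP.toℚᵘ-homo‿- ((+ a) // suc m)) ⟩
  mkℚᵘ (+ 2) 0 ℚᵘ.- toℚᵘ ((+ a) // suc m)
    ≈⟨ ℚᵘP.+-congʳ (mkℚᵘ (+ 2) 0) (ℚᵘP.-‿cong (ℚP.toℚᵘ-fromℚᵘ (mkℚᵘ (+ a) m))) ⟩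
  mkℚᵘ (+ 2) 0 ℚᵘ.- mkℚᵘ (+ a) m
    ≈⟨ *≡* cross-multiplied ⟩
  mkℚᵘ (+ (2 * suc m ∸ a)) m
    ≈⟨ ℚP.toℚᵘ-fromℚᵘ (mkℚᵘ (+ (2 * suc m ∸ a)) m) ⟨
  toℚᵘ ((+ (2 * suc m ∸ a)) // suc m)
    ∎)
  where
  open ℚᵘP.≃-Reasoning
  n : ℤ
  n = + suc m
  difference : + (2 * suc m ∸ a) ≡ + 2 ℤ.* n ℤ.- + a
  difference = trans (sym (ℤP.⊖-≥ a≤2n))
                     (trans (sym (ℤP.m-n≡m⊖n (2 * suc m) a)) (cong (ℤ._- + a) (ℤP.pos-* 2 (suc m))))
  rearrange : ∀ (N A : ℤ) → (+ 2 ℤ.* N ℤ.+ (ℤ.- A) ℤ.* + 1) ℤ.* N ≡ (+ 2 ℤ.* N ℤ.- A) ℤ.* (+ 1 ℤ.* N)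
  rearrange = ℤSolver.solve-∀
  cross-multiplied : (+ 2 ℤ.* n ℤ.+ (ℤ.- + a) ℤ.* + 1) ℤ.* n ≡ + (2 * suc m ∸ a) ℤ.* (+ 1 ℤ.* n)
  cross-multiplied = trans (rearrange n (+ a)) (cong (ℤ._* (+ 1 ℤ.* n)) (sym difference))

two-minus-≤ : ∀ m {a s} → a ≤ 2 * suc m → 2 * suc m ≤ a + s →
              (+ 2) // 1 - (+ a) // suc m ≤ℚ (+ s) // suc m
two-minus-≤ m {a} {s} a≤2n 2n≤a+s =
  subst (_≤ℚ (+ s) // suc m) (sym (two-minus-// m a≤2n)) (//-mono-≤ m (m≤n+o⇒m∸n≤o (2 * suc m) a 2n≤a+s))

two-minus-≡ : ∀ m {a s} → a ≤ 2 * suc m →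
              ((+ s) // suc m ≡ (+ 2) // 1 - (+ a) // suc m) ⇔ (a + s ≡ 2 * suc m)
two-minus-≡ m {a} {s} a≤2n = ⇔-trans
  (mk⇔ (λ eq → //-injective m (trans eq (two-minus-// m a≤2n)))
       (λ eq → trans (cong (λ x → (+ x) // suc m) eq) (sym (two-minus-// m a≤2n))))
  (∸-≡⇔+ a≤2n)

isDominating : ∀ {n} → Graph n → Fin n → Bool
isDominating {n} G u = degree G u ≡ᵇ n ∸ 1

Dominating : ∀ {n} → Graph n → Fin n → Set
Dominating G u = ∀ v → v ≢ u → Edge G u v

numDominating≡count : ∀ {n} (G : Graph n) → numDominating G ≡ count (isDominating G)
numDominating≡count {n} G = Σᵥ≡∑ n _

degree≡count-punchIn : ∀ {m} (G : Graph (suc m)) u → degree G u ≡ count (adj G u ∘ punchIn u)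
degree≡count-punchIn {m} G u = begin
  degree G u
    ≡⟨ Σᵥ≡∑ (suc m) _ ⟩
  count (adj G u)
    ≡⟨ sum-remove {i = u} (λ v → if adj G u v then 1 else 0) ⟩
  (if adj G u u then 1 else 0) + count (adj G u ∘ punchIn u)
    ≡⟨ cong (λ b → (if b then 1 else 0) + count (adj G u ∘ punchIn u)) (irrefl G u) ⟩
  count (adj G u ∘ punchIn u)
    ∎
  where open ≡-Reasoning

all-punchIn⇔all-≢ : ∀ {m} (P : Fin (suc m) → Set) u → (∀ j → P (punchIn u j)) ⇔ (∀ v → v ≢ u → P v)
all-punchIn⇔all-≢ P u = mk⇔
  (λ all v v≢u → subst P (FinP.punchIn-punchOut (v≢u ∘ sym)) (all (punchOut (v≢u ∘ sym))))
  (λ all j → all (punchIn u j) (FinP.punchInᵢ≢i u j))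

≡ᵇ-true⇔≡ : ∀ m n → (m ≡ᵇ n) ≡ true ⇔ m ≡ n
≡ᵇ-true⇔≡ m n =
  mk⇔ (≡ᵇ⇒≡ m n ∘ Equivalence.from BoolP.T-≡) (Equivalence.to BoolP.T-≡ ∘ ≡⇒≡ᵇ m n)

isDominating⇔Dominating : ∀ {n} (G : Graph n) u → isDominating G u ≡ true ⇔ Dominating G u
isDominating⇔Dominating {suc m} G u rewrite degree≡count-punchIn G u =
  ⇔-trans (≡ᵇ-true⇔≡ _ m)
  (⇔-trans (count≡n⇔all (adj G u ∘ punchIn u))
           (all-punchIn⇔all-≢ (Edge G u) u))

module _ {n} (G : Graph n) where

  private
    P : Fin n → Bool
    P = isDominating G

    D : ℕ
    D = count P

  dominant : Fin D → Fin n
  dominant x = merge P (inj₁ x)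

  dominant-adj : ∀ x {v} → v ≢ dominant x → Edge G (dominant x) v
  dominant-adj x {v} = Equivalence.to (isDominating⇔Dominating G (dominant x)) (P-merge P (inj₁ x)) v

  dominant-injective : Injective _≡_ _≡_ dominant
  dominant-injective = SumP.inj₁-injective ∘ merge-injective P

  ≢-dominant : ∀ {u} → P u ≡ false → ∀ x → u ≢ dominant x
  ≢-dominant {u} Pu≡false x refl = contradiction (trans (sym Pu≡false) (P-merge P (inj₁ x))) λ ()

  dominating-exists : 0 < D → ∃ (Dominating G)
  dominating-exists 0<D = dominant (fromℕ< 0<D) , λ v → dominant-adj (fromℕ< 0<D)

-- Walks and eccentricities

exists-other : ∀ {n} → 1 < n → (u : Fin n) → ∃ λ v → v ≢ u
exists-other {suc zero}    (s≤s ()) _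
exists-other {suc (suc m)} _        u = punchIn u zero , FinP.punchInᵢ≢i u zero

module _ {n} (G : Graph n) where

  edge-sym : ∀ {u v} → Edge G u v → Edge G v u
  edge-sym {u} {v} e = trans (Graph.sym G v u) e

  edge⇒≢ : ∀ {u v} → Edge G u v → u ≢ v
  edge⇒≢ {u} e refl = contradiction (trans (sym (irrefl G u)) e) λ ()

  walk? : ∀ ℓ u v → Dec (Walk G u v ℓ)
  walk? zero u v with u ≟ v
  ... | yes refl = yes here
  ... | no u≢v   = no λ { here → u≢v refl }
  walk? (suc ℓ) u v =
    Dec.map′ (λ (w , e , p) → step e p) (λ { (step e p) → _ , e , p })
             (FinP.any? (λ w → (adj G u w BoolP.≟ true) ×-dec walk? ℓ w v))

  distance : Connected G → ∀ u v → ∃ (IsDist G u v)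
  distance conn u v = least (λ ℓ → walk? ℓ u v) (proj₂ (conn u v))

  _++ʷ_ : ∀ {u w v a b} → Walk G u w a → Walk G w v b → Walk G u v (a + b)
  here       ++ʷ q = q
  step e p ++ʷ q = step e (p ++ʷ q)

  walk-≥1 : ∀ {u v ℓ} → u ≢ v → Walk G u v ℓ → 1 ≤ ℓ
  walk-≥1 u≢v here       = contradiction refl u≢v
  walk-≥1 _   (step _ _) = s≤s z≤n

  walk-≥2 : ∀ {u v ℓ} → u ≢ v → adj G u v ≡ false → Walk G u v ℓ → 2 ≤ ℓ
  walk-≥2 u≢v _      here                = contradiction refl u≢v
  walk-≥2 _   u≁v    (step e here)       = contradiction (trans (sym e) u≁v) λ ()
  walk-≥2 _   _      (step _ (step _ _)) = s≤s (s≤s z≤n)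

  Within : ℕ → Fin n → Fin n → Set
  Within b u v = ∃ λ ℓ → ℓ ≤ b × Walk G u v ℓ

  within-1 : ∀ {u v} → u ≡ v ⊎ Edge G u v → Within 1 u v
  within-1 (inj₁ refl) = 0 , z≤n , here
  within-1 (inj₂ e)    = 1 , ≤-refl , step e here

  within-+ : ∀ {a b u w v} → Within a u w → Within b w v → Within (a + b) u v
  within-+ (ℓ , ℓ≤a , p) (ℓ' , ℓ'≤b , q) = ℓ + ℓ' , +-mono-≤ ℓ≤a ℓ'≤b , p ++ʷ q

  dominating-reaches : ∀ {w} → Dominating G w → ∀ v → w ≡ v ⊎ Edge G w v
  dominating-reaches {w} dom v with v ≟ w
  ... | yes refl = inj₁ refl
  ... | no v≢w   = inj₂ (dom v v≢w)

  ecc-≥ : ∀ {u v e b} → Connected G → IsEcc G u e → (∀ {ℓ} → Walk G u v ℓ → b ≤ ℓ) → b ≤ e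
  ecc-≥ {u} {v} conn (far , _) b≤ with distance conn u v
  ... | d , dist = ≤-trans (b≤ (proj₁ dist)) (far v d dist)

  ecc-≤ : ∀ {u e b} → IsEcc G u e → (∀ v → Within b u v) → e ≤ b
  ecc-≤ (_ , v , _ , shortest) near with near v
  ... | ℓ , ℓ≤b , p = ≤-trans (shortest ℓ p) ℓ≤b

  dominating⇒ecc≤1 : ∀ {u e} → Dominating G u → IsEcc G u e → e ≤ 1
  dominating⇒ecc≤1 dom ecc = ecc-≤ ecc (within-1 ∘ dominating-reaches dom)

  dominating⇒ecc≤2 : ∀ {w u e} → Dominating G w → IsEcc G u e → e ≤ 2
  dominating⇒ecc≤2 {w} {u} dom ecc =
    ecc-≤ ecc (λ v → within-+ (within-1 (Sum.map sym edge-sym (dominating-reaches dom u)))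
                              (within-1 (dominating-reaches dom v)))

  nonDominating⇒nonNeighbour : ∀ {u} → isDominating G u ≡ false → ∃ λ v → v ≢ u × adj G u v ≡ false
  nonDominating⇒nonNeighbour {u} notDom with FinP.any? (λ v → ¬? (v ≟ u) ×-dec (adj G u v BoolP.≟ false))
  ... | yes found = found
  ... | no none   = contradiction (trans (sym notDom) (Equivalence.from (isDominating⇔Dominating G u) dom)) λ ()
    where
    dom : Dominating G u
    dom v v≢u = BoolP.¬-not (λ u≁v → none (v , v≢u , u≁v))

  minEcc : Fin n → ℕ
  minEcc u = if isDominating G u then 1 else 2

  minEcc≤ecc : Connected G → 1 < n → ∀ {u e} → IsEcc G u e → minEcc u ≤ e
  minEcc≤ecc conn 1<n {u} ecc with isDominating G u in isDom
  ... | true  = let v , v≢u = exists-other 1<n u in ecc-≥ conn ecc (walk-≥1 (v≢u ∘ sym))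
  ... | false = let v , v≢u , u≁v = nonDominating⇒nonNeighbour isDom
                in ecc-≥ conn ecc (walk-≥2 (v≢u ∘ sym) u≁v)

  ecc≤minEcc : ∀ {w} → Dominating G w → ∀ {u e} → IsEcc G u e → e ≤ minEcc u
  ecc≤minEcc dom {u} ecc with isDominating G u in isDom
  ... | true  = dominating⇒ecc≤1 (Equivalence.to (isDominating⇔Dominating G u) isDom) ecc
  ... | false = dominating⇒ecc≤2 dom ecc

module EccentricitySums {n} (G : Graph n) (conn : Connected G) (1<n : 1 < n)
                        (ecc : Fin n → ℕ) (isEcc : ∀ u → IsEcc G u (ecc u)) where

  private
    D : ℕ
    D = count (isDominating G)

    minEcc²≤ecc² : ∀ u → (if isDominating G u then 1 else 4) ≤ ecc u ^ 2
    minEcc²≤ecc² u = subst (_≤ ecc u ^ 2) (BoolP.if-float (_^ 2) (isDominating G u))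
                           (^-monoˡ-≤ 2 (minEcc≤ecc G conn 1<n (isEcc u)))

    ecc≡minEcc : ∀ {w} → Dominating G w → ∀ u → ecc u ≡ minEcc G u
    ecc≡minEcc dom u = ≤-antisym (ecc≤minEcc G dom (isEcc u)) (minEcc≤ecc G conn 1<n (isEcc u))

  sum-lower : 2 * n ≤ D + Σᵥ n ecc
  sum-lower = subst (2 * n ≤_) (cong₂ _+_ (*-identityˡ D) (sym (Σᵥ≡∑ n ecc)))
    (weightedCount-≤ 1 (isDominating G) ecc (λ u → minEcc≤ecc G conn 1<n (isEcc u)))

  sumSq-lower : 4 * n ≤ 3 * D + σ₁ n ecc
  sumSq-lower = subst (4 * n ≤_) (cong (_+_ (3 * D)) (sym (Σᵥ≡∑ n _)))
    (weightedCount-≤ 3 (isDominating G) (λ u → ecc u ^ 2) minEcc²≤ecc²)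

  sum-exact : ∀ {w} → Dominating G w → D + Σᵥ n ecc ≡ 2 * n
  sum-exact dom = trans (cong₂ _+_ (sym (*-identityˡ D)) (Σᵥ≡∑ n ecc))
    (weightedCount-≡ 1 (isDominating G) ecc (ecc≡minEcc dom))

  sumSq-exact : ∀ {w} → Dominating G w → 3 * D + σ₁ n ecc ≡ 4 * n
  sumSq-exact dom = trans (cong (_+_ (3 * D)) (Σᵥ≡∑ n _))
    (weightedCount-≡ 3 (isDominating G) (λ u → ecc u ^ 2)
      (λ u → trans (cong (_^ 2) (ecc≡minEcc dom u)) (BoolP.if-float (_^ 2) (isDominating G u))))

EccentricityBounds : ∀ {n} → (Fin n → ℕ) → ℕ → Set → Set
EccentricityBounds {n} ecc k E =
  ((+ 2) // 1 - (+ (k ∸ 1)) // n ≤ℚ σ₀ n ecc)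
  × (σ₀ n ecc ≡ (+ 2) // 1 - (+ (k ∸ 1)) // n ⇔ E)
  × (4 * n + 3 ∸ 3 * k ≤ σ₁ n ecc)
  × (σ₁ n ecc ≡ 4 * n + 3 ∸ 3 * k ⇔ E)

bounds-⇔ : ∀ {n} {ecc : Fin n → ℕ} {k E E'} →
           EccentricityBounds ecc k E → E ⇔ E' → EccentricityBounds ecc k E'
bounds-⇔ (σ₀-lower , σ₀-tight , σ₁-lower , σ₁-tight) E⇔E' =
  σ₀-lower , ⇔-trans σ₀-tight E⇔E' , σ₁-lower , ⇔-trans σ₁-tight E⇔E'

eccentricityBounds : ∀ {m} (G : Graph (suc m)) → Connected G →
                     (ecc : Fin (suc m) → ℕ) → (∀ u → IsEcc G u (ecc u)) →
                     ∀ K → 0 < K → K ≤ m → count (isDominating G) ≤ K →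
                     EccentricityBounds ecc (suc K) (count (isDominating G) ≡ K)
eccentricityBounds {m} G conn ecc isEcc K 0<K K≤m D≤K = σ₀-lower , σ₀-tight , σ₁-lower , σ₁-tight
  where
  n : ℕ
  n = suc m

  D : ℕ
  D = count (isDominating G)
  open EccentricitySums G conn (s≤s (≤-trans 0<K K≤m)) ecc isEcc

  K≤2n : K ≤ 2 * n
  K≤2n = ≤-trans (m≤n⇒m≤1+n K≤m) (m≤n*m n 2)

  3K≤4n : 3 * K ≤ 4 * n
  3K≤4n = ≤-trans (*-monoʳ-≤ 3 (m≤n⇒m≤1+n K≤m)) (*-monoˡ-≤ n {3} {4} (m≤n⇒m≤1+n ≤-refl))

  dominating : D ≡ K → ∃ (Dominating G)
  dominating D≡K = dominating-exists G (subst (0 <_) (sym D≡K) 0<K)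

  σ₀-lower : (+ 2) // 1 - (+ K) // n ≤ℚ σ₀ n ecc
  σ₀-lower = two-minus-≤ m K≤2n (≤-trans sum-lower (+-monoˡ-≤ (Σᵥ n ecc) D≤K))

  σ₀-tight : (σ₀ n ecc ≡ (+ 2) // 1 - (+ K) // n) ⇔ (D ≡ K)
  σ₀-tight = ⇔-trans (two-minus-≡ m K≤2n) (mk⇔
    (squeeze D≤K sum-lower)
    (λ D≡K → subst (λ x → x + Σᵥ n ecc ≡ 2 * n) D≡K (sum-exact (proj₂ (dominating D≡K)))))

  σ₁-lower : 4 * n + 3 ∸ 3 * suc K ≤ σ₁ n ecc
  σ₁-lower = subst (_≤ σ₁ n ecc) (sym (+3∸3*suc (4 * n) K))
    (m≤n+o⇒m∸n≤o (4 * n) (3 * K) (≤-trans sumSq-lower (+-monoˡ-≤ (σ₁ n ecc) (*-monoʳ-≤ 3 D≤K))))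

  σ₁-tight : (σ₁ n ecc ≡ 4 * n + 3 ∸ 3 * suc K) ⇔ (D ≡ K)
  σ₁-tight = ⇔-trans
    (subst (λ x → (σ₁ n ecc ≡ x) ⇔ (3 * K + σ₁ n ecc ≡ 4 * n)) (sym (+3∸3*suc (4 * n) K))
           (∸-≡⇔+ 3K≤4n))
    (mk⇔ (λ eq → *-cancelˡ-≡ D K 3 (squeeze (*-monoʳ-≤ 3 D≤K) sumSq-lower eq))
         (λ D≡K → subst (λ x → 3 * x + σ₁ n ecc ≡ 4 * n) D≡K (sumSq-exact (proj₂ (dominating D≡K)))))

-- Cliques

CliquesAtMost : ∀ {n} → Graph n → ℕ → Set
CliquesAtMost {n} G k = ∀ j (f : Fin j → Fin n) → IsClique G j f → j ≤ k

colouring⇒cliquesAtMost : ∀ {n} (G : Graph n) {k c} → ProperColouring G k c → CliquesAtMost G k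
colouring⇒cliquesAtMost G {c = c} proper j f (_ , f-adj) = FinP.injective⇒≤ c∘f-injective
  where
  c∘f-injective : Injective _≡_ _≡_ (c ∘ f)
  c∘f-injective {a} {b} eq with a ≟ b
  ... | yes a≡b = a≡b
  ... | no a≢b  = contradiction eq (proper (f a) (f b) (f-adj a b a≢b))

cliqueNumber⇒cliquesAtMost : ∀ {n} (G : Graph n) {k} → CliqueNumber G k → CliquesAtMost G k
cliqueNumber⇒cliquesAtMost G (_ , noLarger) j f clique = ≮⇒≥ (λ k<j → noLarger j k<j (f , clique))

splitAt-injective : ∀ a {b} {i j : Fin (a + b)} → splitAt a i ≡ splitAt a j → i ≡ j
splitAt-injective a {b} {i} {j} eq =
  trans (sym (FinP.join-splitAt a b i)) (trans (cong (join a b) eq) (FinP.join-splitAt a b j))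

module _ {n} (G : Graph n) where

  singleton-clique : ∀ v → IsClique G 1 (λ _ → v)
  singleton-clique v = (λ { {zero} {zero} _ → refl }) , λ { zero zero 0≢0 → contradiction refl 0≢0 }

  clique-join : ∀ {a b f g} → IsClique G a f → IsClique G b g → (∀ x y → Edge G (f x) (g y)) →
                IsClique G (a + b) ([ f , g ]′ ∘ splitAt a)
  clique-join {a} {b} {f} {g} (f-inj , f-adj) (g-inj , g-adj) across =
    (λ eq → splitAt-injective a (h-inj eq)) , (λ i j i≢j → h-adj _ _ (i≢j ∘ splitAt-injective a))
    where
    h-inj : ∀ {s t} → [ f , g ]′ s ≡ [ f , g ]′ t → s ≡ t
    h-inj {inj₁ x} {inj₁ y} eq = cong inj₁ (f-inj eq)
    h-inj {inj₁ x} {inj₂ y} eq = contradiction eq (edge⇒≢ G (across x y))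
    h-inj {inj₂ y} {inj₁ x} eq = contradiction (sym eq) (edge⇒≢ G (across x y))
    h-inj {inj₂ x} {inj₂ y} eq = cong inj₂ (g-inj eq)
    h-adj : ∀ s t → s ≢ t → Edge G ([ f , g ]′ s) ([ f , g ]′ t)
    h-adj (inj₁ x) (inj₁ y) s≢t = f-adj x y (s≢t ∘ cong inj₁)
    h-adj (inj₁ x) (inj₂ y) _   = across x y
    h-adj (inj₂ y) (inj₁ x) _   = edge-sym G (across x y)
    h-adj (inj₂ x) (inj₂ y) s≢t = g-adj x y (s≢t ∘ cong inj₂)

  edge-clique : ∀ {u v} → Edge G u v → IsClique G 2 ([ (λ _ → u) , (λ _ → v) ]′ ∘ splitAt 1)
  edge-clique u~v = clique-join (singleton-clique _) (singleton-clique _) (λ _ _ → u~v)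

  private
    P : Fin n → Bool
    P = isDominating G

    D : ℕ
    D = count P

  dominant-clique : IsClique G D (dominant G)
  dominant-clique = dominant-injective G , λ x y x≢y → dominant-adj G x (x≢y ∘ sym ∘ dominant-injective G)

  extend-by-dominant : ∀ {j f} → IsClique G j f → (∀ i → P (f i) ≡ false) →
                       IsClique G (j + D) ([ f , dominant G ]′ ∘ splitAt j)
  extend-by-dominant {f = f} clique nonDom = clique-join clique dominant-clique
    (λ x y → edge-sym G (dominant-adj G y (≢-dominant G (nonDom x) y)))

  dominating≤ : ∀ {K} → CliquesAtMost G (suc K) → suc K < n → D ≤ K
  dominating≤ {K} bound K<n with FinP.any? (λ v → P v BoolP.≟ false)
  ... | yes (v , Pv≡false) = s≤s⁻¹ (bound _ _ (extend-by-dominant (singleton-clique v) (λ _ → Pv≡false)))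
  ... | no allDominating = contradiction (bound D (dominant G) dominant-clique) (<⇒≱ (subst (suc K <_) (sym D≡n) K<n))
    where
    D≡n : D ≡ n
    D≡n = Equivalence.from (count≡n⇔all P) (λ v → BoolP.¬-not (allDominating ∘ (v ,_)))

  nonDominating-independent : ∀ {K} → CliquesAtMost G (suc K) → D ≡ K →
                              ∀ u v → P u ≡ false → P v ≡ false → adj G u v ≡ false
  nonDominating-independent {K} bound D≡K u v Pu Pv with adj G u v in u~v
  ... | false = refl
  ... | true  = contradiction (bound _ _ (extend-by-dominant (edge-clique u~v) λ { zero → Pu ; (suc zero) → Pv }))
                              (subst (λ d → 2 + d ≰ suc K) (sym D≡K) 1+n≰n)

-- The join K_a ∨ K̄_b

≅-sym : ∀ {n m} {G : Graph n} {H : Graph m} → G ≅ H → H ≅ G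
≅-sym {G = G} {H} I = record
  { to = from ; from = to ; from∘to = to∘from ; to∘from = from∘to ; pres = pres⁻¹ }
  where
  open _≅_ I
  pres⁻¹ : ∀ u v → adj G (from u) (from v) ≡ adj H u v
  pres⁻¹ u v = trans (sym (pres (from u) (from v))) (cong₂ (adj H) (to∘from u) (to∘from v))

≅-dominating : ∀ {n m} {G : Graph n} {H : Graph m} (I : G ≅ H) {u} → Dominating H u → Dominating G (_≅_.from I u)
≅-dominating {G = G} {H} I {u} dom v v≢from-u = begin
  adj G (from u) v                 ≡⟨ pres (from u) v ⟨
  adj H (to (from u)) (to v)       ≡⟨ cong (λ w → adj H w (to v)) (to∘from u) ⟩
  adj H u (to v)                   ≡⟨ dom (to v) (v≢from-u ∘ v≡from-u) ⟩
  true                             ∎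
  where
  open _≅_ I
  open ≡-Reasoning
  v≡from-u : to v ≡ u → v ≡ from u
  v≡from-u to-v≡u = trans (sym (from∘to v)) (cong from to-v≡u)

KjoinE-dominating : ∀ a b (x : Fin a) → Dominating (KjoinE a b) (x ↑ˡ b)
KjoinE-dominating a b x v v≢x rewrite FinP.splitAt-↑ˡ a x b with splitAt a v in split-v
... | inj₂ _ = refl
... | inj₁ y with x ≟ y
...   | no _     = refl
...   | yes refl = contradiction (sym (FinP.splitAt⁻¹-↑ˡ split-v)) v≢x

≅-KjoinE⇒dominating≥ : ∀ {n} (G : Graph n) {a b} → G ≅ KjoinE a b → a ≤ count (isDominating G)
≅-KjoinE⇒dominating≥ G {a} {b} I = count-≥ (isDominating G) (from ∘ (_↑ˡ b)) injective dominating
  where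
  open _≅_ I
  injective : Injective _≡_ _≡_ (from ∘ (_↑ˡ b))
  injective {i} {j} eq = FinP.↑ˡ-injective b i j (trans (sym (to∘from _)) (trans (cong to eq) (to∘from _)))
  dominating : ∀ x → isDominating G (from (x ↑ˡ b)) ≡ true
  dominating x = Equivalence.from (isDominating⇔Dominating G _) (≅-dominating I (KjoinE-dominating a b x))

KjoinE≅ : ∀ {n} (G : Graph n) →
          (∀ u v → isDominating G u ≡ false → isDominating G v ≡ false → adj G u v ≡ false) →
          KjoinE (count (isDominating G)) (count (not ∘ isDominating G)) ≅ G
KjoinE≅ {n} G independent = record
  { to      = merge P ∘ splitAt D
  ; from    = join D D' ∘ split P
  ; from∘to = λ w → trans (cong (join D D') (split-merge P (splitAt D w))) (FinP.join-splitAt D D' w)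
  ; to∘from = λ u → trans (cong (merge P) (FinP.splitAt-join D D' (split P u))) (merge-split P u)
  ; pres    = pres
  }
  where
  P : Fin n → Bool
  P = isDominating G

  D D' : ℕ
  D = count P
  D' = count (not ∘ P)

  pres : ∀ w w' → adj G (merge P (splitAt D w)) (merge P (splitAt D w')) ≡ joinAdj D D' w w'
  pres w w' with splitAt D w | splitAt D w'
  ... | inj₁ x | inj₁ y with x ≟ y
  ...   | yes refl = irrefl G (dominant G x)
  ...   | no x≢y   = dominant-adj G x (x≢y ∘ sym ∘ dominant-injective G)
  pres w w' | inj₁ x | inj₂ y = dominant-adj G x (≢-dominant G (P-merge P (inj₂ y)) x)
  pres w w' | inj₂ x | inj₁ y = edge-sym G (dominant-adj G y (≢-dominant G (P-merge P (inj₂ x)) y))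
  pres w w' | inj₂ x | inj₂ y = independent _ _ (P-merge P (inj₂ x)) (P-merge P (inj₂ y))

KjoinE-characterisation : ∀ {n} (G : Graph n) {K} → CliquesAtMost G (suc K) → count (isDominating G) ≤ K →
                          (count (isDominating G) ≡ K) ⇔ (G ≅ KjoinE K (n + 1 ∸ suc K))
KjoinE-characterisation {n} G {K} cliques D≤K =
  mk⇔ join-structure (λ I → ≤-antisym D≤K (≅-KjoinE⇒dominating≥ G I))
  where
  P : Fin n → Bool
  P = isDominating G

  D : ℕ
  D = count P

  nonDominating-count : D ≡ K → count (not ∘ P) ≡ n + 1 ∸ suc K
  nonDominating-count D≡K = begin
    count (not ∘ P)            ≡⟨ m+n∸m≡n D (count (not ∘ P)) ⟨
    D + count (not ∘ P) ∸ D    ≡⟨ cong₂ _∸_ (count-complement P) D≡K ⟩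
    n ∸ K                      ≡⟨ cong (_∸ suc K) (+-comm n 1) ⟨
    n + 1 ∸ suc K              ∎
    where open ≡-Reasoning

  join-structure : D ≡ K → G ≅ KjoinE K (n + 1 ∸ suc K)
  join-structure D≡K = subst₂ (λ a b → G ≅ KjoinE a b) D≡K (nonDominating-count D≡K)
    (≅-sym (KjoinE≅ G (nonDominating-independent G cliques D≡K)))

theorem4p2 : ∀ {n : ℕ} (G : Graph n) → Connected G →
    (ecc : Fin n → ℕ) → (∀ u → IsEcc G u (ecc u)) →
    (k : ℕ) → 2 ≤ k → k ≤ n ∸ 1 →
    (ChromaticNumber G k →
      ((+ 2) // 1 - (+ (k ∸ 1)) // n ≤ℚ σ₀ n ecc)
      × (σ₀ n ecc ≡ (+ 2) // 1 - (+ (k ∸ 1)) // n ⇔ G ≅ KjoinE (k ∸ 1) (n + 1 ∸ k))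
      × (4 * n + 3 ∸ 3 * k ≤ σ₁ n ecc)
      × (σ₁ n ecc ≡ 4 * n + 3 ∸ 3 * k ⇔ G ≅ KjoinE (k ∸ 1) (n + 1 ∸ k)))
    × (CliqueNumber G k →
      ((+ 2) // 1 - (+ (k ∸ 1)) // n ≤ℚ σ₀ n ecc)
      × (σ₀ n ecc ≡ (+ 2) // 1 - (+ (k ∸ 1)) // n ⇔ numDominating G ≡ k ∸ 1)
      × (4 * n + 3 ∸ 3 * k ≤ σ₁ n ecc)
      × (σ₁ n ecc ≡ 4 * n + 3 ∸ 3 * k ⇔ numDominating G ≡ k ∸ 1))
theorem4p2 {zero}  G conn ecc isEcc _ (s≤s (s≤s _)) ()
theorem4p2 {suc m} G conn ecc isEcc (suc K) (s≤s (s≤s _)) k≤m = chromatic , cliqueNumber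
  where
  dominating≤K : CliquesAtMost G (suc K) → count (isDominating G) ≤ K
  dominating≤K cliques = dominating≤ G cliques (s≤s k≤m)

  bounds : CliquesAtMost G (suc K) → ∀ {E} → (count (isDominating G) ≡ K) ⇔ E → EccentricityBounds ecc (suc K) E
  bounds cliques = bounds-⇔ {ecc = ecc} {k = suc K}
    (eccentricityBounds G conn ecc isEcc K (s≤s z≤n) (≤-trans (n≤1+n K) k≤m) (dominating≤K cliques))

  chromatic : ChromaticNumber G (suc K) → EccentricityBounds ecc (suc K) (G ≅ KjoinE K (suc m + 1 ∸ suc K))
  chromatic ((_ , proper) , _) = bounds cliques (KjoinE-characterisation G cliques (dominating≤K cliques))
    where
    cliques : CliquesAtMost G (suc K)
    cliques = colouring⇒cliquesAtMost G proper

  cliqueNumber : CliqueNumber G (suc K) → EccentricityBounds ecc (suc K) (numDominating G ≡ K)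
  cliqueNumber ω = bounds (cliqueNumber⇒cliquesAtMost G ω)
    (mk⇔ (trans (numDominating≡count G)) (trans (sym (numDominating≡count G))))
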